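{- Let $G$ be a connected graph with ${\rm diam}(G) = 2$. Then ${\rm gp_{e}}(G) = m(G)$, where $m(G)$ denotes the number of edges of $G$.
   Context: All graphs are finite, simple and connected. A geodesic of $G$ is a shortest path between two vertices of $G$. A set $S$ of edges of $G$ is an edge general position set if no geodesic of $G$ contains three edges of $S$. The edge general position number ${\rm gp_{e}}(G)$ is the maximum cardinality of an edge general position set of $G$. ${\rm diam}(G)$ is the maximum distance between two vertices of $G$. -}

module Defs where

open import Data.Nat using (ℕ; zero; suc; _≤_; _<_)
open import Data.Fin using (Fin; inject₁) renaming (suc to fsuc; zero to fzero)
import Data.Fin as F
open import Data.Fin.Properties using (_<?_)
open import Data.Bool using (Bool; true; false; _∧_)
open import Data.Vec using (Vec; lookup; head; last)
open import Data.List using (List; length; filter; allFin; concatMap; map)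
open import Data.List.Membership.Propositional using (_∈_)
open import Data.List.Relation.Unary.Unique.Propositional using (Unique)
open import Data.Product using (Σ; proj₁; ∃; ∃-syntax; _×_; _,_)
open import Data.Sum using (_⊎_)
open import Relation.Binary.PropositionalEquality using (_≡_; _≢_)
open import Relation.Nullary using (¬_)
open import Relation.Nullary.Decidable using (⌊_⌋)

record Graph (n : ℕ) : Set where
  field
    adj    : Fin n → Fin n → Bool
    sym    : ∀ u v → adj u v ≡ adj v u
    irrefl : ∀ u → adj u u ≡ false
open Graph public

Walk : ∀ {n} → Graph n → Fin n → Fin n → ℕ → Set
Walk {n} G u v k =
  Σ (Vec (Fin n) (suc k)) λ p →
    (head p ≡ u) × (last p ≡ v) ×
    (∀ (i : Fin k) → adj G (lookup p (inject₁ i)) (lookup p (fsuc i)) ≡ true)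

Dist : ∀ {n} → Graph n → Fin n → Fin n → ℕ → Set
Dist G u v d = Walk G u v d × (∀ k → Walk G u v k → d ≤ k)

Connected : ∀ {n} → Graph n → Set
Connected {n} G = ∀ (u v : Fin n) → ∃[ k ] Walk G u v k

Diam : ∀ {n} → Graph n → ℕ → Set
Diam {n} G D =
  (∀ (u v : Fin n) → ∃[ d ] (Dist G u v d × d ≤ D)) ×
  (∃[ u ] ∃[ v ] Dist G u v D)

-- A geodesic: a shortest path, i.e. a walk from u to v of length d_G(u,v).
-- (A shortest walk is automatically a path.)
Geodesic : ∀ {n} → Graph n → Fin n → Fin n → ℕ → Set
Geodesic G u v k = Walk G u v k × (∀ j → Walk G u v j → k ≤ j)

-- Edges are represented canonically as pairs (x , y) with x < y.
Edge : ℕ → Set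
Edge n = Fin n × Fin n

IsEdge : ∀ {n} → Graph n → Edge n → Set
IsEdge G (x , y) = (x F.< y) × (adj G x y ≡ true)

edgeList : ∀ {n} → Graph n → List (Edge n)
edgeList {n} G =
  filter (λ e → Data.Bool._≟_ (⌊ Data.Product.proj₁ e <? Data.Product.proj₂ e ⌋ ∧ adj G (Data.Product.proj₁ e) (Data.Product.proj₂ e)) true)
    (concatMap (λ x → map (λ y → (x , y)) (allFin n)) (allFin n))

m : ∀ {n} → Graph n → ℕ
m G = length (edgeList G)

OnWalk : ∀ {n k} → Vec (Fin n) (suc k) → Edge n → Set
OnWalk {n} {k} p (x , y) =
  ∃[ i ] ((lookup p (inject₁ {k} i) ≡ x × lookup p (fsuc i) ≡ y) ⊎
          (lookup p (inject₁ {k} i) ≡ y × lookup p (fsuc i) ≡ x))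

EdgeGP : ∀ {n} → Graph n → List (Edge n) → Set
EdgeGP G S =
  (∀ {e} → e ∈ S → IsEdge G e) × Unique S ×
  (∀ u v k (g : Geodesic G u v k) (e₁ e₂ e₃ : Edge _) →
     e₁ ∈ S → e₂ ∈ S → e₃ ∈ S → e₁ ≢ e₂ → e₁ ≢ e₃ → e₂ ≢ e₃ →
     ¬ (OnWalk (proj₁ (proj₁ g)) e₁ × OnWalk (proj₁ (proj₁ g)) e₂ ×
        OnWalk (proj₁ (proj₁ g)) e₃))

GpeNumber : ∀ {n} → Graph n → ℕ → Set
GpeNumber G k =
  (∃[ S ] (EdgeGP G S × length S ≡ k)) ×
  (∀ S → EdgeGP G S → length S ≤ k)

module Submission where

-- In a graph of diameter 2 every geodesic has at most two edges, while a walk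
-- with k edges traverses at most k distinct edges. So no geodesic contains three
-- edges of any edge set, the whole edge set is in general position, and it is
-- trivially the largest set of distinct edges.

open import Defs hiding (sym)
open import Data.Nat using (ℕ; _≤_)
open import Data.Nat.Properties using (≤-trans; ≤⇒≯)
open import Data.Fin using (Fin)
import Data.Fin as F
open import Data.Fin.Properties using (_<?_; <-asym; injective⇒≤)
open import Data.Bool using (true; _∧_)
import Data.Bool
open import Data.Bool.Properties using (T-≡; ∧-conicalˡ; ∧-conicalʳ)
open import Data.Vec using (Vec)
open import Data.List using (List; []; _∷_; _++_; length; lookup; filter; allFin; concatMap; map; cartesianProduct)
open import Data.List.Membership.Propositional using (_∈_)
open import Data.List.Membership.Propositional.Properties
  using (∈-lookup; ∈-filter⁺; ∈-filter⁻; ∈-cartesianProduct⁺; ∈-allFin)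
open import Data.List.Relation.Binary.Subset.Propositional using (_⊆_)
open import Data.List.Relation.Unary.All as All using (All; []; _∷_)
open import Data.List.Relation.Unary.Any using (index)
open import Data.List.Relation.Unary.Any.Properties using (lookup-index)
open import Data.List.Relation.Unary.AllPairs using ([]; _∷_)
open import Data.List.Relation.Unary.Unique.Propositional using (Unique)
import Data.List.Relation.Unary.Unique.Propositional.Properties as Unique
open import Data.Product using (proj₁; proj₂; ∃-syntax; _×_; _,_)
open import Data.Sum using (inj₁; inj₂)
open import Data.Empty using (⊥-elim)
open import Function using (_∘_; Equivalence)
open import Relation.Binary.PropositionalEquality using (_≡_; _≢_; refl; sym; trans; cong; cong₂; subst)
open import Relation.Nullary using (¬_; Dec)
open import Relation.Nullary.Decidable using (⌊_⌋; toWitness; fromWitness)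

module _ {A : Set} where

  Unique-lookup-injective : ∀ {xs : List A} → Unique xs →
                            ∀ i j → lookup xs i ≡ lookup xs j → i ≡ j
  Unique-lookup-injective (_ ∷ _) F.zero F.zero _ = refl
  Unique-lookup-injective (x∉ ∷ _) F.zero (F.suc j) eq =
    ⊥-elim (All.lookup x∉ (∈-lookup j) eq)
  Unique-lookup-injective (x∉ ∷ _) (F.suc i) F.zero eq =
    ⊥-elim (All.lookup x∉ (∈-lookup i) (sym eq))
  Unique-lookup-injective (_ ∷ u) (F.suc i) (F.suc j) eq =
    cong F.suc (Unique-lookup-injective u i j eq)

  Unique-injection⇒length≤ : ∀ {xs : List A} {k} → Unique xs →
    (f : ∀ {x} → x ∈ xs → Fin k) →
    (∀ {x y} (x∈ : x ∈ xs) (y∈ : y ∈ xs) → f x∈ ≡ f y∈ → x ≡ y) →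
    length xs ≤ k
  Unique-injection⇒length≤ u f f-inj = injective⇒≤ {f = f ∘ ∈-lookup}
    λ {i} {j} eq → Unique-lookup-injective u i j (f-inj (∈-lookup i) (∈-lookup j) eq)

  Unique-⊆⇒length≤ : ∀ {xs ys : List A} → Unique xs → xs ⊆ ys → length xs ≤ length ys
  Unique-⊆⇒length≤ {ys = ys} u xs⊆ys = Unique-injection⇒length≤ u (index ∘ xs⊆ys)
    λ x∈ y∈ eq → trans (lookup-index (xs⊆ys x∈))
                   (trans (cong (lookup ys) eq) (sym (lookup-index (xs⊆ys y∈))))

concatMap-pairs≡cartesianProduct : ∀ {A B : Set} (xs : List A) (ys : List B) →
  concatMap (λ x → map (λ y → (x , y)) ys) xs ≡ cartesianProduct xs ys
concatMap-pairs≡cartesianProduct [] ys = refl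
concatMap-pairs≡cartesianProduct (x ∷ xs) ys =
  cong (map (x ,_) ys ++_) (concatMap-pairs≡cartesianProduct xs ys)

Canonical : ∀ {n} → Edge n → Set
Canonical (x , y) = x F.< y

module _ {n : ℕ} (G : Graph n) where

  private
    -- The filter predicate of edgeList, named so the filter lemmas can be applied.
    isEdge? : (e : Edge n) → Dec ((⌊ proj₁ e <? proj₂ e ⌋ ∧ adj G (proj₁ e) (proj₂ e)) ≡ true)
    isEdge? e = Data.Bool._≟_ (⌊ proj₁ e <? proj₂ e ⌋ ∧ adj G (proj₁ e) (proj₂ e)) true

    allPairs : List (Edge n)
    allPairs = cartesianProduct (allFin n) (allFin n)

    edgeList≡ : edgeList G ≡ filter isEdge? allPairs
    edgeList≡ = cong (filter isEdge?) (concatMap-pairs≡cartesianProduct (allFin n) (allFin n))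

  edgeList-unique : Unique (edgeList G)
  edgeList-unique = subst Unique (sym edgeList≡)
    (Unique.filter⁺ isEdge? (Unique.cartesianProduct⁺ (Unique.allFin⁺ n) (Unique.allFin⁺ n)))

  ∈-edgeList⁻ : ∀ {e} → e ∈ edgeList G → IsEdge G e
  ∈-edgeList⁻ {x , y} e∈ =
    toWitness (Equivalence.from T-≡ (∧-conicalˡ _ (adj G x y) passes)) ,
    ∧-conicalʳ ⌊ x <? y ⌋ _ passes
    where
    passes : (⌊ x <? y ⌋ ∧ adj G x y) ≡ true
    passes = proj₂ (∈-filter⁻ isEdge? {xs = allPairs} (subst ((x , y) ∈_) edgeList≡ e∈))

  ∈-edgeList⁺ : ∀ {e} → IsEdge G e → e ∈ edgeList G
  ∈-edgeList⁺ {x , y} (x<y , xy∈G) = subst ((x , y) ∈_) (sym edgeList≡)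
    (∈-filter⁺ isEdge? (∈-cartesianProduct⁺ (∈-allFin x) (∈-allFin y)) passes)
    where
    passes : (⌊ x <? y ⌋ ∧ adj G x y) ≡ true
    passes = cong₂ _∧_ (Equivalence.to T-≡ (fromWitness {a? = x <? y} x<y)) xy∈G

  geodesic-length≤diam : ∀ {D} → (∀ u v → ∃[ d ] (Dist G u v d × d ≤ D)) →
                         ∀ {u v k} → Geodesic G u v k → k ≤ D
  geodesic-length≤diam dist≤D {u} {v} (_ , shortest)
    with d , ((walk , _) , d≤D) ← dist≤D u v = ≤-trans (shortest d walk) d≤D

module _ {n k : ℕ} (p : Vec (Fin n) (ℕ.suc k)) where

  OnWalk-step-injective : ∀ {e₁ e₂} → Canonical e₁ → Canonical e₂ →
    (o₁ : OnWalk p e₁) (o₂ : OnWalk p e₂) → proj₁ o₁ ≡ proj₁ o₂ → e₁ ≡ e₂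
  OnWalk-step-injective c₁ c₂ (i , inj₁ (refl , refl)) (.i , inj₁ (refl , refl)) refl = refl
  OnWalk-step-injective c₁ c₂ (i , inj₁ (refl , refl)) (.i , inj₂ (refl , refl)) refl = ⊥-elim (<-asym c₁ c₂)
  OnWalk-step-injective c₁ c₂ (i , inj₂ (refl , refl)) (.i , inj₁ (refl , refl)) refl = ⊥-elim (<-asym c₁ c₂)
  OnWalk-step-injective c₁ c₂ (i , inj₂ (refl , refl)) (.i , inj₂ (refl , refl)) refl = refl

  OnWalk-unique⇒length≤ : ∀ {S} → Unique S → All (λ e → Canonical e × OnWalk p e) S → length S ≤ k
  OnWalk-unique⇒length≤ u onP = Unique-injection⇒length≤ u (proj₁ ∘ proj₂ ∘ All.lookup onP)
    λ x∈ y∈ → OnWalk-step-injective (proj₁ (All.lookup onP x∈)) (proj₁ (All.lookup onP y∈))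
                (proj₂ (All.lookup onP x∈)) (proj₂ (All.lookup onP y∈))

lemma2p1 : ∀ (n : ℕ) (G : Graph n) → Connected G → Diam G 2 → GpeNumber G (m G)
lemma2p1 n G _ (dist≤2 , _) =
  (edgeList G , (∈-edgeList⁻ G , edgeList-unique G , noThreeOnGeodesic) , refl) ,
  λ S (S⊆E , S-unique , _) → Unique-⊆⇒length≤ S-unique (∈-edgeList⁺ G ∘ S⊆E)
  where
  canonical : ∀ {e} → e ∈ edgeList G → Canonical e
  canonical = proj₁ ∘ ∈-edgeList⁻ G

  noThreeOnGeodesic : ∀ u v k (g : Geodesic G u v k) (e₁ e₂ e₃ : Edge n) →
    e₁ ∈ edgeList G → e₂ ∈ edgeList G → e₃ ∈ edgeList G → e₁ ≢ e₂ → e₁ ≢ e₃ → e₂ ≢ e₃ →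
    ¬ (OnWalk (proj₁ (proj₁ g)) e₁ × OnWalk (proj₁ (proj₁ g)) e₂ × OnWalk (proj₁ (proj₁ g)) e₃)
  noThreeOnGeodesic u v k g e₁ e₂ e₃ ∈₁ ∈₂ ∈₃ e₁≢e₂ e₁≢e₃ e₂≢e₃ (o₁ , o₂ , o₃) =
    ≤⇒≯ (geodesic-length≤diam G dist≤2 g)
        (OnWalk-unique⇒length≤ (proj₁ (proj₁ g))
          ((e₁≢e₂ ∷ e₁≢e₃ ∷ []) ∷ (e₂≢e₃ ∷ []) ∷ [] ∷ [])
          ((canonical ∈₁ , o₁) ∷ (canonical ∈₂ , o₂) ∷ (canonical ∈₃ , o₃) ∷ []))
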